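{- Let $\Pi_q$ be a projective plane of order $q$ and $r$ a positive integer with $\binom{r}{2}\le q$. Then $T_r(\Pi_q)\le r+1$, i.e. every set of points that percolates in $r$-neighbor line percolation has percolation time at most $r+1$.
   Context: A finite projective plane $\Pi_q$ of order $q\ge 2$ has point set $\mathcal P$ of size $q^2+q+1$ and $q^2+q+1$ lines; every line contains $q+1$ points, every point lies on $q+1$ lines, any two lines meet in exactly one point and any two points lie on exactly one line. $r$-neighbor line percolation: for a set $A$ of points let $A^0=A$ and for $s\ge1$ let $A^s=A^{s-1}\cup\{P: \exists \text{ line } l\ni P \text{ with } |l\cap A^{s-1}|\ge r\}$; $A$ percolates if $A^k=\mathcal P$ for some $k$, and its percolation time is the least such $k$. $T_r(\Pi_q)$ is the maximum percolation time over all percolating sets. -}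

module Defs where

open import Data.Nat using (ℕ; zero; suc; _+_; _*_; _≤ᵇ_)
open import Data.Bool using (Bool; true; false; _∧_; _∨_; if_then_else_)
open import Data.Fin using (Fin)
open import Data.List using (List; map)
open import Data.Nat.ListAction using (sum)
open import Data.Bool.ListAction using (any)
open import Data.List.Base using (allFin)
open import Data.Product using (Σ)
open import Relation.Binary.PropositionalEquality using (_≡_; _≢_)

count : {n : ℕ} → (Fin n → Bool) → ℕ
count {n} f = sum (map (λ i → if f i then 1 else 0) (allFin n))

size : ℕ → ℕ
size q = q * q + q + 1

-- A finite projective plane of order q: points and lines are both
-- enumerated by Fin (q^2+q+1); inc p l = true iff point p lies on line l.
record ProjectivePlane (q : ℕ) : Set where
  field
    inc : Fin (size q) → Fin (size q) → Bool
    line-size  : ∀ l → count (λ p → inc p l) ≡ suc q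
    point-deg  : ∀ p → count (λ l → inc p l) ≡ suc q
    lines-meet : ∀ l m → l ≢ m → count (λ p → inc p l ∧ inc p m) ≡ 1
    points-join : ∀ p p′ → p ≢ p′ → count (λ l → inc p l ∧ inc p′ l) ≡ 1

PointSet : ℕ → Set
PointSet q = Fin (size q) → Bool

module _ {q : ℕ} (Π : ProjectivePlane q) (r : ℕ) where
  open ProjectivePlane Π

  step : PointSet q → PointSet q
  step A P = A P ∨ any (λ l → inc P l ∧ (r ≤ᵇ count (λ Q → inc Q l ∧ A Q))) (allFin (size q))

  iter : PointSet q → ℕ → PointSet q
  iter A zero = A
  iter A (suc s) = step (iter A s)

  FullAt : PointSet q → ℕ → Set
  FullAt A k = ∀ P → iter A k P ≡ true

  Percolates : PointSet q → Set
  Percolates A = Σ ℕ (λ k → FullAt A k)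

module Submission where

-- Suppose A percolates but is not yet full at time s. Every round that adds a point P adds it
-- because some line l through P already had r infected points, and then all of l is infected one
-- round later; P lies on none of the earlier such lines, so l is new. Hence by time r either
-- everything is infected or there are r distinct lines L₁, …, Lᵣ all of whose points are infected.
-- Take any point P off these lines. A line through P meets ⋃ Lᵢ in fewer than r points only if it
-- passes through some Lᵢ ∩ Lⱼ, and each of these C(r,2) points lies on exactly one line through P.
-- Since P lies on q + 1 > C(r,2) lines, some line through P has r infected points, so P is
-- infected at time r + 1.

open import Defs
open import Data.Bool using (Bool; true; false; T; not; _∧_; _∨_; if_then_else_)
open import Data.Bool.Properties using (T-∧; T-∨; T-≡; T-not-≡)
open import Data.Bool.ListAction using (any)
open import Data.Empty using (⊥-elim)
open import Data.Fin using (Fin)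
open import Data.Fin.Properties using (_≟_) renaming (any? to anyFin?)
open import Data.List using (List; []; _∷_; map; length; allFin)
open import Data.List.Membership.Propositional using (_∈_; lose)
open import Data.List.Membership.Propositional.Properties using (∈-allFin)
open import Data.List.Relation.Unary.All using (All; []; _∷_; tabulate) renaming (map to All-map)
open import Data.List.Relation.Unary.AllPairs using ([]; _∷_)
open import Data.List.Relation.Unary.Any using (here; there; satisfied) renaming (map to Any-map)
open import Data.List.Relation.Unary.Any.Properties using (any⁺; any⁻)
open import Data.List.Relation.Unary.Unique.Propositional using (Unique)
open import Data.Nat using (ℕ; zero; suc; _+_; _≤_; _<_; _<ᵇ_; z≤n; s≤s)
open import Data.Nat.Combinatorics using (_C_; nC1≡n; nCk+nC[k+1]≡[n+1]C[k+1])
open import Data.Nat.ListAction using (sum)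
open import Data.Nat.Properties
  using ( ≤-trans; ≤-reflexive; ≤-pred; m≤n⇒m≤1+n; 1+n≰n; n≮0; ≮⇒≥; n<1+n; +-comm; +-suc; +-identityʳ
        ; +-mono-≤; +-cancelˡ-<; <⇒<ᵇ; <ᵇ⇒<; ≤⇒≤ᵇ; ≤ᵇ⇒≤; module ≤-Reasoning )
open import Data.Product using (∃; _×_; _,_; proj₁; proj₂)
open import Data.Sum using (_⊎_; inj₁; inj₂)
open import Function using (_∘_)
open import Function.Bundles using (Equivalence)
open import Relation.Nullary using (¬_; Dec; yes; no)
open import Relation.Nullary.Decidable using (T?; ¬?; _×-dec_; ⌊_⌋; toWitness; fromWitness)
open import Relation.Binary.PropositionalEquality using (_≡_; _≢_; refl; sym; trans; cong; subst; module ≡-Reasoning)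

open Equivalence using (to; from)

-- Agda cannot solve x from T (x ∧ y) (T and _∧_ are not injective), so x is passed explicitly.
T-∧⁻ : ∀ x {y} → T (x ∧ y) → T x × T y
T-∧⁻ x = to (T-∧ {x})

T-∧⁺ : ∀ x {y} → T x → T y → T (x ∧ y)
T-∧⁺ x tx ty = from (T-∧ {x}) (tx , ty)

T-∨⁻ : ∀ x {y} → T (x ∨ y) → T x ⊎ T y
T-∨⁻ x = to (T-∨ {x})

T-∨⁺ˡ : ∀ x {y} → T x → T (x ∨ y)
T-∨⁺ˡ x = from (T-∨ {x}) ∘ inj₁

T-∨⁺ʳ : ∀ x {y} → T y → T (x ∨ y)
T-∨⁺ʳ x = from (T-∨ {x}) ∘ inj₂

T-not⁺ : ∀ {x} → ¬ T x → T (not x)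
T-not⁺ {false} _  = _
T-not⁺ {true}  ¬t = ¬t _

module _ {A : Set} where

  countIn : List A → (A → Bool) → ℕ
  countIn xs f = sum (map (λ x → if f x then 1 else 0) xs)

  countIn-mono : ∀ xs {f g : A → Bool} → (∀ x → T (f x) → T (g x)) → countIn xs f ≤ countIn xs g
  countIn-mono []       f⇒g = z≤n
  countIn-mono (x ∷ xs) {f} {g} f⇒g with f x in fx | g x in gx
  ... | true  | true  = s≤s (countIn-mono xs f⇒g)
  ... | true  | false = ⊥-elim (subst T gx (f⇒g x (subst T (sym fx) _)))
  ... | false | true  = m≤n⇒m≤1+n (countIn-mono xs f⇒g)
  ... | false | false = countIn-mono xs f⇒g

  countIn-∨ : ∀ xs (f g : A → Bool) → countIn xs (λ x → f x ∨ g x) ≤ countIn xs f + countIn xs g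
  countIn-∨ []       f g = z≤n
  countIn-∨ (x ∷ xs) f g with f x | g x
  ... | true  | true  = s≤s (≤-trans (m≤n⇒m≤1+n (countIn-∨ xs f g)) (≤-reflexive (sym (+-suc _ _))))
  ... | true  | false = s≤s (countIn-∨ xs f g)
  ... | false | true  = ≤-trans (s≤s (countIn-∨ xs f g)) (≤-reflexive (sym (+-suc _ _)))
  ... | false | false = countIn-∨ xs f g

  countIn-partition : ∀ xs (g f : A → Bool) →
    countIn xs g ≡ countIn xs (λ x → g x ∧ f x) + countIn xs (λ x → g x ∧ not (f x))
  countIn-partition []       g f = refl
  countIn-partition (x ∷ xs) g f with g x | f x
  ... | true  | true  = cong suc (countIn-partition xs g f)
  ... | true  | false = trans (cong suc (countIn-partition xs g f)) (sym (+-suc _ _))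
  ... | false | true  = countIn-partition xs g f
  ... | false | false = countIn-partition xs g f

  countIn-pos : ∀ {xs} {f : A → Bool} {x} → x ∈ xs → T (f x) → 0 < countIn xs f
  countIn-pos {x ∷ xs} {f} (here refl) fx with f x
  ... | true = s≤s z≤n
  countIn-pos {y ∷ xs} {f} (there x∈xs) fx with f y
  ... | true  = s≤s z≤n
  ... | false = countIn-pos x∈xs fx

  countIn-witness : ∀ xs {f : A → Bool} → 0 < countIn xs f → ∃ λ x → T (f x)
  countIn-witness (x ∷ xs) {f} pos with f x in fx
  ... | true  = x , subst T (sym fx) _
  ... | false = countIn-witness xs pos

  countIn-none : ∀ xs {f : A → Bool} → (∀ x → ¬ T (f x)) → countIn xs f ≡ 0
  countIn-none []       none = refl
  countIn-none (x ∷ xs) {f} none with f x in fx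
  ... | true  = ⊥-elim (none x (subst T (sym fx) _))
  ... | false = countIn-none xs none

  countIn-strict : ∀ xs {f g : A → Bool} {x} → x ∈ xs → (∀ y → T (f y) → T (g y)) →
    T (g x) → ¬ T (f x) → suc (countIn xs f) ≤ countIn xs g
  countIn-strict xs {f} {g} x∈xs f⇒g gx ¬fx = begin
    suc (countIn xs f)                   ≡⟨ +-comm 1 _ ⟩
    countIn xs f + 1                     ≤⟨ +-mono-≤ (countIn-mono xs f⇒g∧f) g∧¬f-pos ⟩
    countIn xs (λ y → g y ∧ f y) + countIn xs (λ y → g y ∧ not (f y)) ≡⟨ countIn-partition xs g f ⟨
    countIn xs g                         ∎
    where
    open ≤-Reasoning
    f⇒g∧f : ∀ y → T (f y) → T (g y ∧ f y)
    f⇒g∧f y fy = from T-∧ (f⇒g y fy , fy)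
    g∧¬f-pos : 0 < countIn xs (λ y → g y ∧ not (f y))
    g∧¬f-pos = countIn-pos x∈xs (from T-∧ (gx , T-not⁺ ¬fx))

  countIn-any≤length : ∀ {B : Set} xs (Ms : List B) (g : B → A → Bool) →
    All (λ M → countIn xs (g M) ≤ 1) Ms → countIn xs (λ x → any (λ M → g M x) Ms) ≤ length Ms
  countIn-any≤length xs []       g []         = ≤-reflexive (countIn-none xs λ _ ())
  countIn-any≤length xs (M ∷ Ms) g (g≤1 ∷ gs) =
    ≤-trans (countIn-∨ xs (g M) _) (+-mono-≤ g≤1 (countIn-any≤length xs Ms g gs))

count≡1⇒unique : ∀ {n} {f : Fin n → Bool} → count f ≡ 1 → ∀ {x y} → T (f x) → T (f y) → x ≡ y
count≡1⇒unique {n} {f} count≡1 {x} {y} fx fy with x ≟ y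
... | yes x≡y = x≡y
... | no  x≢y = ⊥-elim (1+n≰n (subst (2 ≤_) count≡1 two≤count))
  where
  isX : Fin n → Bool
  isX z = ⌊ z ≟ x ⌋ ∧ f z
  isX⇒≡x : ∀ z → T (isX z) → z ≡ x
  isX⇒≡x z isX-z = toWitness {a? = z ≟ x} (proj₁ (to (T-∧ {⌊ z ≟ x ⌋}) isX-z))
  two≤count : 2 ≤ count f
  two≤count = ≤-trans (s≤s (countIn-pos {f = isX} (∈-allFin x) (from T-∧ (fromWitness refl , fx))))
    (countIn-strict (allFin n) {isX} {f} (∈-allFin y) (λ z → proj₂ ∘ to T-∧) fy
      (x≢y ∘ sym ∘ isX⇒≡x y))

module Geometry {q : ℕ} (Π : ProjectivePlane q) where
  open ProjectivePlane Π

  Point Line : Set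
  Point = Fin (size q)
  Line  = Fin (size q)

  meet : ∀ {L M} → L ≢ M → ∃ λ X → T (inc X L ∧ inc X M)
  meet {L} {M} L≢M = countIn-witness (allFin _) (≤-reflexive (sym (lines-meet L M L≢M)))

  meet-unique : ∀ {L M X Y} → L ≢ M → T (inc X L ∧ inc X M) → T (inc Y L ∧ inc Y M) → X ≡ Y
  meet-unique {L} {M} L≢M = count≡1⇒unique (lines-meet L M L≢M)

  concurrent : Line → Line → Line → Bool
  concurrent L M m = any (λ X → inc X L ∧ inc X M ∧ inc X m) (allFin _)

  concurrent-intro : ∀ {L M m} X → T (inc X L) → T (inc X M) → T (inc X m) → T (concurrent L M m)
  concurrent-intro X X∈L X∈M X∈m =
    any⁺ _ (lose (∈-allFin X) (from T-∧ (X∈L , from T-∧ (X∈M , X∈m))))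

  count-lines-through-meet≤1 : ∀ {P L M} → ¬ T (inc P L) → L ≢ M →
    count (λ m → inc P m ∧ concurrent L M m) ≤ 1
  count-lines-through-meet≤1 {P} {L} {M} P∉L L≢M = begin
    count (λ m → inc P m ∧ concurrent L M m) ≤⟨ countIn-mono (allFin _) through-X ⟩
    count (λ m → inc P m ∧ inc X m)          ≡⟨ points-join P X P≢X ⟩
    1                                        ∎
    where
    open ≤-Reasoning
    X = proj₁ (meet L≢M)
    X∈L∩M = proj₂ (meet L≢M)
    P≢X : P ≢ X
    P≢X refl = P∉L (proj₁ (to T-∧ X∈L∩M))
    through-X : ∀ m → T (inc P m ∧ concurrent L M m) → T (inc P m ∧ inc X m)
    through-X m P∈m∧conc =
      let P∈m , conc    = T-∧⁻ (inc P m) P∈m∧conc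
          Y , Y∈L∩M∩m   = satisfied (any⁻ _ (allFin _) conc)
          Y∈L , Y∈M∩m   = T-∧⁻ (inc Y L) Y∈L∩M∩m
          Y∈M , Y∈m     = T-∧⁻ (inc Y M) Y∈M∩m
          Y≡X           = meet-unique {X = Y} L≢M (from T-∧ (Y∈L , Y∈M)) X∈L∩M
      in from T-∧ (P∈m , subst (λ Z → T (inc Z m)) Y≡X Y∈m)

  onSome : List Line → Point → Bool
  onSome Ls X = any (inc X) Ls

  infix 4 _⊆_
  _⊆_ : PointSet q → PointSet q → Set
  B ⊆ B′ = ∀ P → T (B P) → T (B′ P)

  pointsOn : Line → PointSet q → ℕ
  pointsOn l B = count (λ Q → inc Q l ∧ B Q)

  pointsOn-mono : ∀ l {B B′} → B ⊆ B′ → pointsOn l B ≤ pointsOn l B′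
  pointsOn-mono l {B} {B′} B⊆B′ = countIn-mono (allFin _) l∩B⊆l∩B′
    where
    l∩B⊆l∩B′ : ∀ Q → T (inc Q l ∧ B Q) → T (inc Q l ∧ B′ Q)
    l∩B⊆l∩B′ Q Q∈l∩B = let Q∈l , Q∈B = T-∧⁻ (inc Q l) Q∈l∩B in T-∧⁺ (inc Q l) Q∈l (B⊆B′ Q Q∈B)

  pointsOn-onSome-∷ : ∀ {L Ls m} → m ≢ L → ¬ T (any (λ M → concurrent L M m) Ls) →
    suc (pointsOn m (onSome Ls)) ≤ pointsOn m (onSome (L ∷ Ls))
  pointsOn-onSome-∷ {L} {Ls} {m} m≢L ¬conc =
    countIn-strict (allFin _) (∈-allFin X) onSome-∷ (T-∧⁺ (inc X m) X∈m (T-∨⁺ˡ (inc X L) X∈L)) X∉⋃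
    where
    X = proj₁ (meet m≢L)
    X∈m = proj₁ (to T-∧ (proj₂ (meet m≢L)))
    X∈L = proj₂ (to T-∧ (proj₂ (meet m≢L)))
    onSome-∷ : ∀ Y → T (inc Y m ∧ onSome Ls Y) → T (inc Y m ∧ onSome (L ∷ Ls) Y)
    onSome-∷ Y Y∈m∩⋃ = let Y∈m , Y∈⋃ = T-∧⁻ (inc Y m) Y∈m∩⋃ in
      T-∧⁺ (inc Y m) Y∈m (T-∨⁺ʳ (inc Y L) Y∈⋃)
    X∉⋃ : ¬ T (inc X m ∧ onSome Ls X)
    X∉⋃ X∈m∩⋃ = ¬conc (any⁺ _ (Any-map (λ X∈M → concurrent-intro X X∈L X∈M X∈m)
                                         (any⁻ _ Ls (proj₂ (T-∧⁻ (inc X m) X∈m∩⋃)))))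

  deficient : Point → List Line → Line → Bool
  deficient P Ls m = inc P m ∧ (pointsOn m (onSome Ls) <ᵇ length Ls)

  deficient-∷ : ∀ {P L Ls} → ¬ T (inc P L) → ∀ m → T (deficient P (L ∷ Ls) m) →
    T (deficient P Ls m) ⊎ T (any (λ M → inc P m ∧ concurrent L M m) Ls)
  deficient-∷ {P} {L} {Ls} P∉L m def with T-∧⁻ (inc P m) def
  ... | P∈m , few with T? (any (λ M → concurrent L M m) Ls)
  ...   | yes conc = inj₂ (any⁺ _ (Any-map (T-∧⁺ (inc P m) P∈m) (any⁻ _ Ls conc)))
  ...   | no ¬conc = inj₁ (T-∧⁺ (inc P m) P∈m (<⇒<ᵇ (≤-pred (begin-strict
      suc (pointsOn m (onSome Ls))    ≤⟨ pointsOn-onSome-∷ {Ls = Ls} m≢L ¬conc ⟩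
      pointsOn m (onSome (L ∷ Ls))    <⟨ <ᵇ⇒< _ _ few ⟩
      suc (length Ls)       ∎))))
    where
    open ≤-Reasoning
    m≢L : m ≢ L
    m≢L refl = P∉L P∈m

  suc-C-2 : ∀ k → suc k C 2 ≡ k C 2 + k
  suc-C-2 k = begin
    suc k C 2         ≡⟨ nCk+nC[k+1]≡[n+1]C[k+1] k 1 ⟨
    k C 1 + k C 2     ≡⟨ cong (_+ k C 2) (nC1≡n k) ⟩
    k + k C 2         ≡⟨ +-comm k _ ⟩
    k C 2 + k         ∎
    where open ≡-Reasoning

  count-deficient≤ : ∀ {P} Ls → ¬ T (onSome Ls P) → Unique Ls → count (deficient P Ls) ≤ length Ls C 2
  count-deficient≤ {P} [] _ _ =
    ≤-reflexive (countIn-none (allFin (size q)) λ m def →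
      n≮0 (<ᵇ⇒< (pointsOn m (onSome [])) 0 (proj₂ (T-∧⁻ (inc P m) def))))
  count-deficient≤ {P} (L ∷ Ls) P∉⋃ (L≢Ls ∷ unique) = begin
    count (deficient P (L ∷ Ls))
      ≤⟨ countIn-mono (allFin _) (λ m → from T-∨ ∘ deficient-∷ {Ls = Ls} P∉L m) ⟩
    count (λ m → deficient P Ls m ∨ through-meet m)
      ≤⟨ countIn-∨ (allFin _) (deficient P Ls) through-meet ⟩
    count (deficient P Ls) + count through-meet
      ≤⟨ +-mono-≤ (count-deficient≤ Ls (P∉⋃ ∘ T-∨⁺ʳ (inc P L)) unique)
                  (countIn-any≤length (allFin _) Ls (λ M m → inc P m ∧ concurrent L M m)
                    (All-map (count-lines-through-meet≤1 P∉L) L≢Ls)) ⟩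
    length Ls C 2 + length Ls
      ≡⟨ suc-C-2 (length Ls) ⟨
    suc (length Ls) C 2 ∎
    where
    open ≤-Reasoning
    P∉L : ¬ T (inc P L)
    P∉L = P∉⋃ ∘ T-∨⁺ˡ (inc P L)
    through-meet : Line → Bool
    through-meet m = any (λ M → inc P m ∧ concurrent L M m) Ls

  rich-line-through : ∀ {P} Ls → ¬ T (onSome Ls P) → Unique Ls → length Ls C 2 ≤ q →
    ∃ λ m → T (inc P m) × length Ls ≤ pointsOn m (onSome Ls)
  rich-line-through {P} Ls P∉⋃ unique C≤q =
    let m , good = countIn-witness (allFin _) non-deficient-pos
        P∈m , not-few = T-∧⁻ (inc P m) good
    in m , P∈m , ≮⇒≥ (λ few → subst T (to T-not-≡ not-few) (<⇒<ᵇ few))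
    where
    non-deficient : Line → Bool
    non-deficient m = inc P m ∧ not (pointsOn m (onSome Ls) <ᵇ length Ls)
    lines-through-P : suc q ≡ count (deficient P Ls) + count non-deficient
    lines-through-P = trans (sym (point-deg P)) (countIn-partition (allFin _) (inc P) _)
    non-deficient-pos : 0 < count non-deficient
    non-deficient-pos = +-cancelˡ-< (count (deficient P Ls)) 0 _ (begin-strict
      count (deficient P Ls) + 0 ≡⟨ +-identityʳ _ ⟩
      count (deficient P Ls)     ≤⟨ ≤-trans (count-deficient≤ Ls P∉⋃ unique) C≤q ⟩
      q                          <⟨ n<1+n q ⟩
      suc q                      ≡⟨ lines-through-P ⟩
      count (deficient P Ls) + count non-deficient ∎)
      where open ≤-Reasoning

module Percolation {q : ℕ} (Π : ProjectivePlane q) (r : ℕ) where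
  open ProjectivePlane Π
  open Geometry Π

  RichIn : PointSet q → Line → Set
  RichIn B l = r ≤ pointsOn l B

  step-intro : ∀ {B P l} → T (inc P l) → RichIn B l → T (step Π r B P)
  step-intro {B} {P} {l} P∈l rich =
    T-∨⁺ʳ (B P) (any⁺ _ (lose (∈-allFin l) (T-∧⁺ (inc P l) P∈l (≤⇒≤ᵇ rich))))

  step-elim : ∀ {B P} → T (step Π r B P) → T (B P) ⊎ ∃ λ l → T (inc P l) × RichIn B l
  step-elim {B} {P} P∈step with T-∨⁻ (B P) P∈step
  ... | inj₁ P∈B   = inj₁ P∈B
  ... | inj₂ on-rich with satisfied (any⁻ _ (allFin _) on-rich)
  ...   | l , P∈l∧rich = let P∈l , rich = T-∧⁻ (inc P l) P∈l∧rich in inj₂ (l , P∈l , ≤ᵇ⇒≤ r _ rich)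

  step-extensive : ∀ B → B ⊆ step Π r B
  step-extensive B P = T-∨⁺ˡ (B P)

  step-mono : ∀ {B B′} → B ⊆ B′ → step Π r B ⊆ step Π r B′
  step-mono {B} {B′} B⊆B′ P P∈step with step-elim P∈step
  ... | inj₁ P∈B              = step-extensive B′ P (B⊆B′ P P∈B)
  ... | inj₂ (l , P∈l , rich) = step-intro P∈l (≤-trans rich (pointsOn-mono l B⊆B′))

  iter-mono : ∀ A s n → iter Π r A s ⊆ iter Π r A (n + s)
  iter-mono A s zero    P P∈As = P∈As
  iter-mono A s (suc n) P P∈As = step-extensive _ P (iter-mono A s n P P∈As)

  iter-stable : ∀ {A s} → step Π r (iter Π r A s) ⊆ iter Π r A s → ∀ n → iter Π r A (n + s) ⊆ iter Π r A s
  iter-stable stuck zero    = λ P P∈As → P∈As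
  iter-stable stuck (suc n) = λ P P∈step → stuck P (step-mono (iter-stable stuck n) P P∈step)

  FullAt-suc : ∀ {A s} → FullAt Π r A s → FullAt Π r A (suc s)
  FullAt-suc {A} {s} full P = to T-≡ (step-extensive (iter Π r A s) P (from T-≡ (full P)))

  full-or-new-point : ∀ {A} → Percolates Π r A → ∀ s →
    FullAt Π r A s ⊎ ∃ λ P → T (iter Π r A (suc s) P) × ¬ T (iter Π r A s P)
  full-or-new-point {A} (k , full-k) s
    with anyFin? (λ P → T? (iter Π r A (suc s) P) ×-dec ¬? (T? (iter Π r A s P)))
  ... | yes new = inj₂ new
  ... | no ¬new = inj₁ λ P → to T-≡ (iter-stable stuck k P
                    (subst (λ t → T (iter Π r A t P)) (+-comm s k) (iter-mono A k s P (from T-≡ (full-k P)))))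
    where
    stuck : step Π r (iter Π r A s) ⊆ iter Π r A s
    stuck P P∈step with T? (iter Π r A s P)
    ... | yes P∈As = P∈As
    ... | no  P∉As = ⊥-elim (¬new (P , P∈step , P∉As))

  record LinesWithin (B : PointSet q) (s : ℕ) : Set where
    field
      lines        : List Line
      length-lines : length lines ≡ s
      unique       : Unique lines
      within       : onSome lines ⊆ B

  no-lines : ∀ B → LinesWithin B 0
  no-lines B = record { lines = [] ; length-lines = refl ; unique = [] ; within = λ _ () }

  lines-within-step : ∀ {B s P} → LinesWithin B s → T (step Π r B P) → ¬ T (B P) →
    LinesWithin (step Π r B) (suc s)
  lines-within-step {B} {s} {P} ls P∈step P∉B with step-elim P∈step
  ... | inj₁ P∈B = ⊥-elim (P∉B P∈B)
  ... | inj₂ (l , P∈l , rich) = record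
    { lines        = l ∷ lines
    ; length-lines = cong suc length-lines
    ; unique       = tabulate l≢ ∷ unique
    ; within       = within′
    }
    where
    open LinesWithin ls
    l≢ : ∀ {M} → M ∈ lines → l ≢ M
    l≢ M∈lines refl = P∉B (within P (any⁺ _ (lose M∈lines P∈l)))
    within′ : onSome (l ∷ lines) ⊆ step Π r B
    within′ X X∈⋃ with T-∨⁻ (inc X l) X∈⋃
    ... | inj₁ X∈l = step-intro X∈l rich
    ... | inj₂ X∈lines = step-extensive B X (within X X∈lines)

  full-or-lines-within : ∀ {A} → Percolates Π r A → ∀ s → FullAt Π r A s ⊎ LinesWithin (iter Π r A s) s
  full-or-lines-within perc zero = inj₂ (no-lines _)
  full-or-lines-within perc (suc s) with full-or-new-point perc s | full-or-lines-within perc s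
  ... | inj₁ full               | _         = inj₁ (FullAt-suc {s = s} full)
  ... | inj₂ _                  | inj₁ full = inj₁ (FullAt-suc {s = s} full)
  ... | inj₂ (P , P∈new , P∉old) | inj₂ ls  = inj₂ (lines-within-step ls P∈new P∉old)

  step-full : ∀ {B} → LinesWithin B r → r C 2 ≤ q → ∀ P → T (step Π r B P)
  step-full {B} ls C≤q P = by-cases (T? (onSome lines P))
    where
    open LinesWithin ls
    by-cases : Dec (T (onSome lines P)) → T (step Π r B P)
    by-cases (yes P∈⋃) = step-extensive B P (within P P∈⋃)
    by-cases (no  P∉⋃) =
      let m , P∈m , r≤|m∩⋃| =
            rich-line-through lines P∉⋃ unique (subst (λ k → k C 2 ≤ q) (sym length-lines) C≤q)
      in step-intro P∈m (≤-trans (≤-reflexive (sym length-lines))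
                                 (≤-trans r≤|m∩⋃| (pointsOn-mono m within)))

proposition16 : (q : ℕ) → 2 ≤ q → (Π : ProjectivePlane q) → (r : ℕ) → 1 ≤ r → r C 2 ≤ q →
    (A : PointSet q) → Percolates Π r A → FullAt Π r A (r + 1)
proposition16 q _ Π r _ C≤q A perc = subst (FullAt Π r A) (+-comm 1 r) full-at-suc-r
  where
  open Percolation Π r
  full-at-suc-r : FullAt Π r A (suc r)
  full-at-suc-r with full-or-lines-within perc r
  ... | inj₁ full-at-r = FullAt-suc {s = r} full-at-r
  ... | inj₂ ls        = λ P → to T-≡ (step-full ls C≤q P)
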